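{- Fix an integer $k\ge 2$. For every $n$ there exists a pseudo-PI-sequence with $n$ states and $k$ actions per state whose size $m_n$ satisfies $m_n = \frac{k}{k-1}\cdot\frac{k^n}{n} + o\!\left(\frac{k^n}{n}\right)$ as $n\to\infty$.
   Context: Policies are vectors $\pi\in\{1,\dots,k\}^n$ (state $s\in\{1,\dots,n\}$ receives action $\pi(s)$). A collection $U$ of state–action pairs is well-defined if each state appears at most once; then $\pi\oplus U$ is obtained from $\pi$ by setting the action at $s$ to $a$ for each $(s,a)\in U$. A pseudo-PI-sequence of size $m$ is a triple $(\Pi,O,\mathcal{T})$ where: $O$ is a finite sequence of distinct policies, totally ordered by position, with $\pi\prec\pi'$ meaning $\pi$ comes before $\pi'$ in $O$; $\mathcal{T}$ assigns to each policy $\pi$ in $O$ an abstract improvement set $T^\pi$, a set of pairs $(s,a)$ with $a\neq\pi(s)$, and $S^\pi$ denotes the set of states appearing in $T^\pi$; and $\Pi=\pi_0,\pi_1,\dots,\pi_{m-1}$ is a subsequence of $O$ (in the same order). It is required that: (i) for any two policies $\pi\prec\pi'$ in $O$ there is a state $s\in S^\pi$ with $\pi(s)\ne\pi'(s)$ and $(s,\pi(s))\notin T^{\pi'}$; (ii) for each $0\le i<m-1$, $O$ contains at least $|S^{\pi_i}|$ policies $\pi$ with $\pi_i\prec\pi\prec\pi_{i+1}$. -}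

module Defs where

open import Data.Nat using (ℕ; suc; _+_; _≤_)
open import Data.Fin using (Fin; toℕ) renaming (_<_ to _<ᶠ_)
open import Data.Bool using (Bool; true; false)
open import Data.Vec using (Vec; lookup; tabulate)
open import Data.List using (allFin)
open import Data.Bool.ListAction using (any)
open import Data.Fin.Subset using (Subset; ∣_∣)
open import Data.Product using (∃; _×_)
open import Relation.Binary.PropositionalEquality using (_≡_; _≢_)

Policy : ℕ → ℕ → Set
Policy n k = Vec (Fin k) n

statesOf : ∀ {n k} → (Fin n → Fin k → Bool) → Subset n
statesOf {n} {k} T = tabulate (λ s → any (T s) (allFin k))

-- O is the ordered sequence of distinct policies O 0, O 1, …, O (len-1)
-- (order = position); T p is the abstract improvement set of O p;
-- Π is the subsequence given by strictly increasing positions idx.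
record PseudoPI (n k m : ℕ) : Set where
  field
    len        : ℕ
    O          : Fin len → Policy n k
    O-distinct : ∀ p q → O p ≡ O q → p ≡ q
    T          : Fin len → Fin n → Fin k → Bool
    T-improving : ∀ p s → T p s (lookup (O p) s) ≡ false
    idx        : Fin m → Fin len
    idx-mono   : ∀ i j → i <ᶠ j → idx i <ᶠ idx j
    cond-i : ∀ p q → p <ᶠ q →
      ∃ λ s → lookup (statesOf (T p)) s ≡ true
            × lookup (O p) s ≢ lookup (O q) s
            × T q s (lookup (O p) s) ≡ false
    -- condition (ii): at least |S^{π_i}| policies strictly between π_i and π_{i+1};
    -- the positions strictly between idx i and idx j number toℕ(idx j) - toℕ(idx i) - 1.
    cond-ii : ∀ (i j : Fin m) → toℕ j ≡ suc (toℕ i) →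
      suc (toℕ (idx i)) + ∣ statesOf (T (idx i)) ∣ ≤ toℕ (idx j)

-- Let action 0 be a resting action and T^π the pairs (s, 0) with π(s) ≠ 0, so that S^π is
-- the set of active states of π.  Condition (i) then holds for π ≺ σ as soon as σ ≠ π and σ
-- has no more active states than π: some active state of π is changed by σ, and T^σ only
-- proposes action 0.  So any repetition-free list of policies ordered by decreasing number
-- of active states will do.  The C(n,j)(k-1)^j policies with j active states are cut into
-- ⌊C(n,j)(k-1)^j / (j+1)⌋ blocks of j + 1 consecutive policies whose first elements form Π,
-- which gives condition (ii).  By (j+1) C(n+1,j+1) = (n+1) C(n,j) the blocks number
-- (k^(n+1) − 1) / ((n+1)(k-1)) up to an additive n + 1, so m n (k-1) misses k^(n+1) by about
-- k^(n+1) / (n+1) plus a polynomial in n, both o(k^n).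

module Submission where

open import Defs
open import Data.Nat using (ℕ; _+_; _*_; _∸_; _^_; _≤_; ∣_-_∣)
open import Data.Product using (Σ; ∃; proj₁)

open import Data.Nat.Base using (zero; suc; _<_; z≤n; s≤s; s≤s⁻¹)
open import Data.Nat.Properties
open import Data.Nat.Tactic.RingSolver using (solve-∀)
open import Data.Nat.DivMod using (_/_; _%_; m≡m%n+[m/n]*n; m%n<n; m/n*n≤m)
open import Data.Fin.Base as F using (Fin; toℕ)
import Data.Fin.Properties as Fin
open import Data.Vec.Base using ([]; _∷_; lookup)
open import Data.Vec.Properties using (lookup∘tabulate; ∷-injectiveʳ)
open import Data.List.Base as L
  using (List; []; _∷_; _++_; [_]; length; map; take; drop; allFin; concatMap; cartesianProductWith)
open import Data.List.Properties
  using (length-++; length-map; length-tabulate; length-take; length-drop; take-[]; concatMap-++)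
open import Data.List.NonEmpty.Base using (List⁺; _∷_; head; tail; toList)
open import Data.List.Relation.Unary.All as All using (All; []; _∷_)
import Data.List.Relation.Unary.All.Properties as All
open import Data.List.Relation.Unary.AllPairs using (AllPairs; []; _∷_)
import Data.List.Relation.Unary.AllPairs.Properties as AllPairs
open import Data.List.Relation.Unary.Unique.Propositional using (Unique)
import Data.List.Relation.Unary.Unique.Propositional.Properties as Unique
open import Data.List.Relation.Binary.Disjoint.Propositional using (Disjoint)
open import Data.List.Membership.Propositional.Properties using (∈-lookup; ∈-map⁻; ∈-cartesianProductWith⁻)
open import Data.Bool.Base using (Bool; true; false; not; _∧_; _∨_)
open import Data.Bool.Properties using (∧-zeroʳ; ∧-identityʳ; ∧-inverseʳ; ∨-identityʳ)
open import Data.Bool.ListAction using (any)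
open import Data.Fin.Subset using (∣_∣)
open import Data.Product using (_×_; _,_; proj₂)
open import Data.Empty using (⊥-elim)
open import Function.Base using (_∘_; id)
open import Relation.Nullary using (yes; no)
open import Relation.Binary.PropositionalEquality hiding ([_])
open import Relation.Binary.Definitions using (tri<; tri≈; tri>)

private variable
  A : Set
  n K j : ℕ

take-+ : ∀ m k (xs : List A) → take (m + k) xs ≡ take m xs ++ take k (drop m xs)
take-+ zero    k xs       = refl
take-+ (suc m) k []       = sym (take-[] k)
take-+ (suc m) k (x ∷ xs) = cong (x ∷_) (take-+ m k xs)

length-cartesianProductWith : ∀ {B C : Set} (f : A → B → C) xs ys →
  length (cartesianProductWith f xs ys) ≡ length xs * length ys
length-cartesianProductWith f []       ys = refl
length-cartesianProductWith f (x ∷ xs) ys = begin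
  length (map (f x) ys ++ cartesianProductWith f xs ys)
    ≡⟨ length-++ (map (f x) ys) ⟩
  length (map (f x) ys) + length (cartesianProductWith f xs ys)
    ≡⟨ cong₂ _+_ (length-map (f x) ys) (length-cartesianProductWith f xs ys) ⟩
  length ys + length xs * length ys ∎
  where open ≡-Reasoning

AllPairs-lookup : ∀ {R : A → A → Set} {xs} → AllPairs R xs →
  ∀ {i j : Fin (length xs)} → i F.< j → R (L.lookup xs i) (L.lookup xs j)
AllPairs-lookup (Rx ∷ _)   {F.zero}  {F.suc j} _   = All.lookup Rx (∈-lookup j)
AllPairs-lookup (_  ∷ Rxs) {F.suc i} {F.suc j} i<j = AllPairs-lookup Rxs (s≤s⁻¹ i<j)

flatten : List (List⁺ A) → List A
flatten = concatMap toList

All-head : ∀ {P : A → Set} (bs : List (List⁺ A)) → All P (flatten bs) → All (P ∘ head) bs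
All-head []             _   = []
All-head ((x ∷ r) ∷ bs) (px ∷ pr) = px ∷ All-head bs (All.++⁻ʳ r pr)

skip : (r ys : List A) → Fin (length ys) → Fin (length (r ++ ys))
skip []      _ p = p
skip (_ ∷ r) ys p = F.suc (skip r ys p)

lookup-skip : ∀ (r ys : List A) (p : Fin (length ys)) → L.lookup (r ++ ys) (skip r ys p) ≡ L.lookup ys p
lookup-skip []      _ p = refl
lookup-skip (_ ∷ r) ys p = lookup-skip r ys p

toℕ-skip : ∀ (r ys : List A) (p : Fin (length ys)) → toℕ (skip r ys p) ≡ length r + toℕ p
toℕ-skip []      _ p = refl
toℕ-skip (_ ∷ r) ys p = cong suc (toℕ-skip r ys p)

skip-mono : ∀ (r ys : List A) {p q : Fin (length ys)} → p F.< q → skip r ys p F.< skip r ys q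
skip-mono []      _ p<q = p<q
skip-mono (_ ∷ r) ys p<q = s≤s (skip-mono r ys p<q)

headPos : (bs : List (List⁺ A)) → Fin (length bs) → Fin (length (flatten bs))
headPos ((x ∷ r) ∷ bs) F.zero    = F.zero
headPos ((x ∷ r) ∷ bs) (F.suc i) = F.suc (skip r (flatten bs) (headPos bs i))

lookup-headPos : ∀ (bs : List (List⁺ A)) i → L.lookup (flatten bs) (headPos bs i) ≡ head (L.lookup bs i)
lookup-headPos ((x ∷ r) ∷ bs) F.zero    = refl
lookup-headPos ((x ∷ r) ∷ bs) (F.suc i) = trans (lookup-skip r (flatten bs) (headPos bs i)) (lookup-headPos bs i)

headPos-mono : ∀ (bs : List (List⁺ A)) {i j} → i F.< j → headPos bs i F.< headPos bs j
headPos-mono ((x ∷ r) ∷ bs) {F.zero}  {F.suc j} _   = s≤s z≤n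
headPos-mono ((x ∷ r) ∷ bs) {F.suc i} {F.suc j} i<j = s≤s (skip-mono r (flatten bs) (headPos-mono bs (s≤s⁻¹ i<j)))

headPos-gap : ∀ (bs : List (List⁺ A)) i j → toℕ j ≡ suc (toℕ i) →
  toℕ (headPos bs j) ≡ suc (toℕ (headPos bs i)) + length (tail (L.lookup bs i))
headPos-gap ((x ∷ r) ∷ bs@(_ ∷ _)) F.zero (F.suc F.zero) refl =
  cong suc (trans (toℕ-skip r (flatten bs) F.zero) (+-identityʳ (length r)))
headPos-gap ((x ∷ r) ∷ bs) (F.suc i) (F.suc j) j≡1+i = cong suc (begin
  toℕ (skip r (flatten bs) (headPos bs j))        ≡⟨ toℕ-skip r (flatten bs) (headPos bs j) ⟩
  length r + toℕ (headPos bs j)                   ≡⟨ cong (length r +_) (headPos-gap bs i j (suc-injective j≡1+i)) ⟩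
  length r + (suc (toℕ (headPos bs i)) + t)       ≡⟨ +-suc (length r) _ ⟩
  suc (length r + (toℕ (headPos bs i) + t))       ≡⟨ cong suc (+-assoc (length r) _ t) ⟨
  suc (length r + toℕ (headPos bs i)) + t         ≡⟨ cong (λ m → suc m + t) (toℕ-skip r (flatten bs) (headPos bs i)) ⟨
  suc (toℕ (skip r (flatten bs) (headPos bs i))) + t ∎)
  where
  open ≡-Reasoning
  t = length (tail (L.lookup bs i))

chunks : ℕ → ℕ → List A → List (List⁺ A)
chunks j zero    xs       = []
chunks j (suc c) []       = []
chunks j (suc c) (x ∷ xs) = (x ∷ take j xs) ∷ chunks j c (drop j xs)

flatten-chunks : ∀ j c (xs : List A) → flatten (chunks j c xs) ≡ take (c * suc j) xs
flatten-chunks j zero    xs       = refl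
flatten-chunks j (suc c) []       = refl
flatten-chunks j (suc c) (x ∷ xs) = cong (x ∷_) (begin
  take j xs ++ flatten (chunks j c (drop j xs))    ≡⟨ cong (take j xs ++_) (flatten-chunks j c (drop j xs)) ⟩
  take j xs ++ take (c * suc j) (drop j xs)        ≡⟨ take-+ j (c * suc j) xs ⟨
  take (j + c * suc j) xs                          ∎)
  where open ≡-Reasoning

≤-length-drop : ∀ j m (xs : List A) → j + m ≤ length xs → m ≤ length (drop j xs)
≤-length-drop j m xs j+m≤ =
  subst (m ≤_) (sym (length-drop j xs)) (m+n≤o⇒m≤o∸n m (subst (_≤ length xs) (+-comm j m) j+m≤))

length-chunks : ∀ j c (xs : List A) → c * suc j ≤ length xs → length (chunks j c xs) ≡ c
length-chunks j zero    xs       _ = refl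
length-chunks j (suc c) (x ∷ xs) (s≤s room) =
  cong suc (length-chunks j c (drop j xs) (≤-length-drop j (c * suc j) xs room))

chunks-tail : ∀ j c (xs : List A) → c * suc j ≤ length xs → All (λ b → length (tail b) ≡ j) (chunks j c xs)
chunks-tail j zero    xs       _ = []
chunks-tail j (suc c) (x ∷ xs) (s≤s room) =
  trans (length-take j xs) (m≤n⇒m⊓n≡m (m+n≤o⇒m≤o j room))
  ∷ chunks-tail j c (drop j xs) (≤-length-drop j (c * suc j) xs room)

∑ : ℕ → (ℕ → ℕ) → ℕ
∑ zero    f = 0
∑ (suc J) f = f J + ∑ J f

syntax ∑ J (λ j → e) = ∑[ j < J ] e

∑-mono-≤ : ∀ J {f g : ℕ → ℕ} → (∀ j → f j ≤ g j) → ∑ J f ≤ ∑ J g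
∑-mono-≤ zero    f≤g = z≤n
∑-mono-≤ (suc J) f≤g = +-mono-≤ (f≤g J) (∑-mono-≤ J f≤g)

*-distribˡ-∑ : ∀ c J (f : ℕ → ℕ) → c * ∑ J f ≡ ∑[ j < J ] (c * f j)
*-distribˡ-∑ c zero    f = *-zeroʳ c
*-distribˡ-∑ c (suc J) f = trans (*-distribˡ-+ c (f J) _) (cong (c * f J +_) (*-distribˡ-∑ c J f))

∑-+-const : ∀ J (f : ℕ → ℕ) c → ∑[ j < J ] (f j + c) ≡ ∑ J f + J * c
∑-+-const zero    f c = refl
∑-+-const (suc J) f c = trans (cong ((f J + c) +_) (∑-+-const J f c)) (interchange (f J) c (∑ J f) (J * c))
  where
  interchange : ∀ a b x y → (a + b) + (x + y) ≡ (a + x) + (b + y)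
  interchange = solve-∀

∑-shift : ∀ J (f : ℕ → ℕ) → ∑ (suc J) f ≡ f 0 + ∑[ j < J ] f (suc j)
∑-shift zero    f = refl
∑-shift (suc J) f = trans (cong (f (suc J) +_) (∑-shift J f)) (swap (f (suc J)) (f 0) _)
  where
  swap : ∀ a b c → a + (b + c) ≡ b + (a + c)
  swap = solve-∀

active : ∀ {k} → Fin k → Bool
active F.zero    = false
active (F.suc _) = true

activeCount : ∀ {k} → Policy n k → ℕ
activeCount []            = 0
activeCount (F.zero  ∷ π) = activeCount π
activeCount (F.suc _ ∷ π) = suc (activeCount π)

improve : Policy n (suc K) → Fin n → Fin (suc K) → Bool
improve π s a = active (lookup π s) ∧ not (active a)

any-tabulate-false : ∀ {m} (p : A → Bool) (f : Fin m → A) → (∀ i → p (f i) ≡ false) →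
  any p (L.tabulate f) ≡ false
any-tabulate-false {m = zero}  p f _       = refl
any-tabulate-false {m = suc m} p f p∘f≡false rewrite p∘f≡false F.zero =
  any-tabulate-false p (f ∘ F.suc) (p∘f≡false ∘ F.suc)

any-improve : ∀ (π : Policy n (suc K)) s → any (improve π s) (allFin (suc K)) ≡ active (lookup π s)
any-improve π s = trans
  (cong₂ _∨_ (∧-identityʳ _) (any-tabulate-false (improve π s) F.suc (λ _ → ∧-zeroʳ _)))
  (∨-identityʳ _)

∣statesOf-improve∣ : ∀ (π : Policy n (suc K)) → ∣ statesOf (improve π) ∣ ≡ activeCount π
∣statesOf-improve∣ []            = refl
∣statesOf-improve∣ (F.zero  ∷ π) rewrite any-improve (F.zero ∷ π) F.zero = ∣statesOf-improve∣ π
∣statesOf-improve∣ (F.suc a ∷ π) rewrite any-improve (F.suc a ∷ π) F.zero = cong suc (∣statesOf-improve∣ π)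

Separated : Policy n (suc K) → Policy n (suc K) → Set
Separated {n} π σ = Σ (Fin n) λ s → active (lookup π s) ≡ true × lookup π s ≢ lookup σ s

Separated-∷ : ∀ {a b} {π σ : Policy n (suc K)} → Separated π σ → Separated (a ∷ π) (b ∷ σ)
Separated-∷ (s , p) = F.suc s , p

separated-< : ∀ (π σ : Policy n (suc K)) → activeCount σ < activeCount π → Separated π σ

separated : ∀ (π σ : Policy n (suc K)) → activeCount σ ≤ activeCount π → π ≢ σ → Separated π σ
separated []            []            _   π≢σ = ⊥-elim (π≢σ refl)
separated (F.zero  ∷ π) (F.zero  ∷ σ) σ≤π π≢σ = Separated-∷ (separated π σ σ≤π (π≢σ ∘ cong (F.zero ∷_)))
separated (F.zero  ∷ π) (F.suc _ ∷ σ) σ<π _   = Separated-∷ (separated-< π σ σ<π)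
separated (F.suc a ∷ π) (b ∷ σ) σ≤π π≢σ with F.suc a Fin.≟ b
... | no  a≢b  = F.zero , refl , a≢b
... | yes refl = Separated-∷ (separated π σ (s≤s⁻¹ σ≤π) (π≢σ ∘ cong (F.suc a ∷_)))

separated-< π σ σ<π = separated π σ (<⇒≤ σ<π) (λ π≡σ → <⇒≢ σ<π (cong activeCount (sym π≡σ)))

equal-activeCount-separated : ∀ {xs : List (Policy n (suc K))} →
  All (λ π → activeCount π ≡ j) xs → Unique xs → AllPairs Separated xs
equal-activeCount-separated []          []            = []
equal-activeCount-separated (πj ∷ πsj) (π∉πs ∷ uniq) =
  All.zipWith (λ (σj , π≢σ) → separated _ _ (≤-reflexive (trans σj (sym πj))) π≢σ) (πsj , π∉πs)
  ∷ equal-activeCount-separated πsj uniq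

Separated⇒≢ : ∀ {π σ : Policy n (suc K)} → Separated π σ → π ≢ σ
Separated⇒≢ (s , _ , πs≢σs) π≡σ = πs≢σs (cong (λ τ → lookup τ s) π≡σ)

Separated⇒condition-i : ∀ {π σ : Policy n (suc K)} → Separated π σ →
  ∃ λ s → lookup (statesOf (improve π)) s ≡ true
        × lookup π s ≢ lookup σ s
        × improve σ s (lookup π s) ≡ false
Separated⇒condition-i {π = π} {σ} (s , πs-active , πs≢σs) =
  s , trans (lookup∘tabulate _ s) (trans (any-improve π s) πs-active)
    , πs≢σs
    , trans (cong (λ b → active (lookup σ s) ∧ not b) πs-active) (∧-zeroʳ _)

Budgeted : List⁺ (Policy n (suc K)) → Set
Budgeted b = activeCount (head b) ≤ length (tail b)

blocksPseudoPI : (bs : List (List⁺ (Policy n (suc K)))) →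
  AllPairs Separated (flatten bs) → All Budgeted bs → PseudoPI n (suc K) (length bs)
blocksPseudoPI {n} {K} bs separated budgeted = record
  { len         = length (flatten bs)
  ; O           = O
  ; O-distinct  = O-injective
  ; T           = improve ∘ O
  ; T-improving = λ p s → ∧-inverseʳ (active (lookup (O p) s))
  ; idx         = headPos bs
  ; idx-mono    = λ _ _ → headPos-mono bs
  ; cond-i      = λ p q p<q → Separated⇒condition-i {π = O p} {O q} (AllPairs-lookup separated p<q)
  ; cond-ii     = gap
  }
  where
  O : Fin (length (flatten bs)) → Policy n (suc K)
  O = L.lookup (flatten bs)

  O-injective : ∀ p q → O p ≡ O q → p ≡ q
  O-injective p q Op≡Oq with Fin.<-cmp p q
  ... | tri< p<q _ _ = ⊥-elim (Separated⇒≢ (AllPairs-lookup separated p<q) Op≡Oq)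
  ... | tri≈ _ p≡q _ = p≡q
  ... | tri> _ _ q<p = ⊥-elim (Separated⇒≢ (AllPairs-lookup separated q<p) (sym Op≡Oq))

  gap : ∀ i j → toℕ j ≡ suc (toℕ i) →
    suc (toℕ (headPos bs i)) + ∣ statesOf (improve (O (headPos bs i))) ∣ ≤ toℕ (headPos bs j)
  gap i j j≡1+i = begin
    suc (toℕ (headPos bs i)) + ∣ statesOf (improve (O (headPos bs i))) ∣
      ≡⟨ cong (suc (toℕ (headPos bs i)) +_)
              (trans (∣statesOf-improve∣ (O (headPos bs i))) (cong activeCount (lookup-headPos bs i))) ⟩
    suc (toℕ (headPos bs i)) + activeCount (head (L.lookup bs i))
      ≤⟨ +-monoʳ-≤ (suc (toℕ (headPos bs i))) (All.lookup budgeted (∈-lookup i)) ⟩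
    suc (toℕ (headPos bs i)) + length (tail (L.lookup bs i))
      ≡⟨ headPos-gap bs i j j≡1+i ⟨
    toℕ (headPos bs j) ∎
    where open ≤-Reasoning

withActive : ∀ K n → ℕ → List (Policy n (suc K))
withActive K zero    zero    = [ [] ]
withActive K zero    (suc j) = []
withActive K (suc n) zero    = map (F.zero ∷_) (withActive K n zero)
withActive K (suc n) (suc j) =
  map (F.zero ∷_) (withActive K n (suc j)) ++ cartesianProductWith (λ a π → F.suc a ∷ π) (allFin K) (withActive K n j)

-- numWithActive K n j = (n choose j) · K ^ j
numWithActive : ℕ → ℕ → ℕ → ℕ
numWithActive K zero    zero    = 1
numWithActive K zero    (suc j) = 0
numWithActive K (suc n) zero    = numWithActive K n zero
numWithActive K (suc n) (suc j) = numWithActive K n (suc j) + K * numWithActive K n j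

length-withActive : ∀ K n j → length (withActive K n j) ≡ numWithActive K n j
length-withActive K zero    zero    = refl
length-withActive K zero    (suc j) = refl
length-withActive K (suc n) zero    = trans (length-map _ (withActive K n zero)) (length-withActive K n zero)
length-withActive K (suc n) (suc j) = begin
  length (zeros ++ sucs)                                 ≡⟨ length-++ zeros ⟩
  length zeros + length sucs                             ≡⟨ cong₂ _+_ (length-map _ (withActive K n (suc j)))
                                                                      (length-cartesianProductWith _ (allFin K) (withActive K n j)) ⟩
  length (withActive K n (suc j)) + length (allFin K) * length (withActive K n j)
                                                         ≡⟨ cong₂ (λ a b → a + b * length (withActive K n j))
                                                                  (length-withActive K n (suc j)) (length-tabulate {n = K} id) ⟩
  numWithActive K n (suc j) + K * length (withActive K n j)
                                                         ≡⟨ cong (λ a → numWithActive K n (suc j) + K * a) (length-withActive K n j) ⟩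
  numWithActive K (suc n) (suc j)                        ∎
  where
  open ≡-Reasoning
  zeros = map (F.zero ∷_) (withActive K n (suc j))
  sucs  = cartesianProductWith (λ a π → F.suc a ∷ π) (allFin K) (withActive K n j)

withActive-activeCount : ∀ K n j → All (λ π → activeCount π ≡ j) (withActive K n j)
withActive-activeCount K zero    zero    = refl ∷ []
withActive-activeCount K zero    (suc j) = []
withActive-activeCount K (suc n) zero    = All.map⁺ (withActive-activeCount K n zero)
withActive-activeCount K (suc n) (suc j) = All.++⁺
  (All.map⁺ (withActive-activeCount K n (suc j)))
  (All.cartesianProductWith⁺ (setoid _) (setoid _) _ (allFin K) (withActive K n j)
    (λ _ π∈ → cong suc (All.lookup (withActive-activeCount K n j) π∈)))

withActive-unique : ∀ K n j → Unique (withActive K n j)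
withActive-unique K zero    zero    = [] ∷ []
withActive-unique K zero    (suc j) = []
withActive-unique K (suc n) zero    = Unique.map⁺ ∷-injectiveʳ (withActive-unique K n zero)
withActive-unique K (suc n) (suc j) = Unique.++⁺
  (Unique.map⁺ ∷-injectiveʳ (withActive-unique K n (suc j)))
  (Unique.cartesianProductWith⁺ _ suc∷-injective (Unique.allFin⁺ K) (withActive-unique K n j))
  heads-differ
  where
  zeros = map (F.zero ∷_) (withActive K n (suc j))
  sucs  = cartesianProductWith (λ a π → F.suc a ∷ π) (allFin K) (withActive K n j)
  suc∷-injective : ∀ {a b : Fin K} {π σ : Policy n (suc K)} → F.suc a ∷ π ≡ F.suc b ∷ σ → a ≡ b × π ≡ σ
  suc∷-injective refl = refl , refl
  heads-differ : Disjoint zeros sucs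
  heads-differ (τ∈zeros , τ∈sucs) with ∈-map⁻ (F.zero ∷_) τ∈zeros | ∈-cartesianProductWith⁻ _ (allFin K) _ τ∈sucs
  ... | _ , _ , refl | _ , _ , _ , _ , ()

numWithActive-beyond : ∀ K n j → n < j → numWithActive K n j ≡ 0
numWithActive-beyond K zero    (suc j) _         = refl
numWithActive-beyond K (suc n) (suc j) (s≤s n<j) = begin
  numWithActive K n (suc j) + K * numWithActive K n j
    ≡⟨ cong₂ (λ a b → a + K * b) (numWithActive-beyond K n (suc j) (m≤n⇒m≤1+n n<j)) (numWithActive-beyond K n j n<j) ⟩
  0 + K * 0 ≡⟨ *-zeroʳ K ⟩
  0 ∎
  where open ≡-Reasoning

numWithActive-zero : ∀ K n → numWithActive K n 0 ≡ 1
numWithActive-zero K zero    = refl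
numWithActive-zero K (suc n) = numWithActive-zero K n

∑-numWithActive-suc : ∀ K n J →
  ∑[ j < suc J ] numWithActive K (suc n) j ≡ ∑[ j < suc J ] numWithActive K n j + K * ∑[ j < J ] numWithActive K n j
∑-numWithActive-suc K n zero    = sym (trans (cong (numWithActive K n 0 + 0 +_) (*-zeroʳ K)) (+-identityʳ _))
∑-numWithActive-suc K n (suc J) = trans
  (cong (numWithActive K (suc n) (suc J) +_) (∑-numWithActive-suc K n J))
  (regroup (numWithActive K n (suc J)) (numWithActive K n J) K
           (∑[ j < suc J ] numWithActive K n j) (∑[ j < J ] numWithActive K n j))
  where
  regroup : ∀ a b K s t → (a + K * b) + (s + K * t) ≡ (a + s) + K * (b + t)
  regroup = solve-∀

∑-numWithActive : ∀ K n → ∑[ j < suc n ] numWithActive K n j ≡ suc K ^ n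
∑-numWithActive K zero    = refl
∑-numWithActive K (suc n) = begin
  ∑[ j < suc (suc n) ] numWithActive K (suc n) j
    ≡⟨ ∑-numWithActive-suc K n (suc n) ⟩
  (numWithActive K n (suc n) + ∑[ j < suc n ] numWithActive K n j) + K * ∑[ j < suc n ] numWithActive K n j
    ≡⟨ cong₂ (λ a b → (a + b) + K * b) (numWithActive-beyond K n (suc n) ≤-refl) (∑-numWithActive K n) ⟩
  suc K ^ suc n ∎
  where open ≡-Reasoning

∑-numWithActive-positive : ∀ K n → suc (∑[ j < n ] numWithActive K n (suc j)) ≡ suc K ^ n
∑-numWithActive-positive K n = begin
  suc (∑[ j < n ] numWithActive K n (suc j))
    ≡⟨ cong (_+ ∑[ j < n ] numWithActive K n (suc j)) (numWithActive-zero K n) ⟨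
  numWithActive K n 0 + ∑[ j < n ] numWithActive K n (suc j)
    ≡⟨ ∑-shift n (numWithActive K n) ⟨
  ∑[ j < suc n ] numWithActive K n j
    ≡⟨ ∑-numWithActive K n ⟩
  suc K ^ n ∎
  where open ≡-Reasoning

numWithActive-absorption : ∀ K n j → suc j * numWithActive K (suc n) (suc j) ≡ suc n * K * numWithActive K n j
numWithActive-absorption K zero    zero    = base K
  where
  base : ∀ K → 1 * (0 + K * 1) ≡ 1 * K * 1
  base = solve-∀
numWithActive-absorption K zero    (suc j) = vanish K j
  where
  vanish : ∀ K j → suc (suc j) * (0 + K * 0) ≡ 1 * K * 0
  vanish = solve-∀
numWithActive-absorption K (suc n) zero    = begin
  1 * (a + K * z)         ≡⟨ +-identityʳ _ ⟩
  a + K * z               ≡⟨ cong (_+ K * z) (trans (sym (*-identityˡ a)) (numWithActive-absorption K n 0)) ⟩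
  suc n * K * z + K * z   ≡⟨ regroup n K z ⟩
  suc (suc n) * K * z     ∎
  where
  open ≡-Reasoning
  a = numWithActive K (suc n) 1
  z = numWithActive K n 0
  regroup : ∀ n K z → suc n * K * z + K * z ≡ suc (suc n) * K * z
  regroup = solve-∀
numWithActive-absorption K (suc n) (suc j) = begin
  suc (suc j) * (b + K * a)
    ≡⟨ expand j b K a ⟩
  suc (suc j) * b + K * (suc j * a) + K * a
    ≡⟨ cong₂ (λ x y → x + K * y + K * a) (numWithActive-absorption K n (suc j)) (numWithActive-absorption K n j) ⟩
  suc n * K * numWithActive K n (suc j) + K * (suc n * K * numWithActive K n j) + K * a
    ≡⟨ regroup n K (numWithActive K n (suc j)) (numWithActive K n j) ⟩
  suc (suc n) * K * a ∎
  where
  open ≡-Reasoning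
  a = numWithActive K (suc n) (suc j)
  b = numWithActive K (suc n) (suc (suc j))
  expand : ∀ j b K a → suc (suc j) * (b + K * a) ≡ suc (suc j) * b + K * (suc j * a) + K * a
  expand = solve-∀
  regroup : ∀ n K x y → suc n * K * x + K * (suc n * K * y) + K * (x + K * y) ≡ suc (suc n) * K * (x + K * y)
  regroup = solve-∀

quotient-sandwich : ∀ {a b d w} → suc d * a ≡ w * b → w * (b / suc d) ≤ a × a ≤ w * (b / suc d) + w
quotient-sandwich {a} {b} {d} {w} d*a≡w*b = *-cancelˡ-≤ (suc d) lower , *-cancelˡ-≤ (suc d) upper
  where
  open ≤-Reasoning
  c = b / suc d
  r = b % suc d
  d*a≡ : suc d * a ≡ w * r + suc d * (w * c)
  d*a≡ = trans d*a≡w*b (trans (cong (w *_) (m≡m%n+[m/n]*n b (suc d))) (split w r c d))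
    where
    split : ∀ w r c d → w * (r + c * suc d) ≡ w * r + suc d * (w * c)
    split = solve-∀
  lower : suc d * (w * c) ≤ suc d * a
  lower = begin
    suc d * (w * c)          ≤⟨ m≤n+m _ (w * r) ⟩
    w * r + suc d * (w * c)  ≡⟨ d*a≡ ⟨
    suc d * a                ∎
  upper : suc d * a ≤ suc d * (w * c + w)
  upper = begin
    suc d * a                    ≡⟨ d*a≡ ⟩
    w * r + suc d * (w * c)      ≤⟨ +-monoˡ-≤ _ (*-monoʳ-≤ w (<⇒≤ (m%n<n b (suc d)))) ⟩
    w * suc d + suc d * (w * c)  ≡⟨ regroup w d c ⟩
    suc d * (w * c + w)          ∎
    where
    regroup : ∀ w d c → w * suc d + suc d * (w * c) ≡ suc d * (w * c + w)
    regroup = solve-∀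

module Construction (K n : ℕ) where

  quota : ℕ → ℕ
  quota j = numWithActive K n j / suc j

  quota-fits : ∀ j → quota j * suc j ≤ length (withActive K n j)
  quota-fits j = subst (quota j * suc j ≤_) (sym (length-withActive K n j)) (m/n*n≤m _ (suc j))

  levelBlocks : ℕ → List (List⁺ (Policy n (suc K)))
  levelBlocks j = chunks j (quota j) (withActive K n j)

  blocks : ℕ → List (List⁺ (Policy n (suc K)))
  blocks zero    = []
  blocks (suc j) = levelBlocks j ++ blocks j

  flatten-levelBlocks : ∀ j → flatten (levelBlocks j) ≡ take (quota j * suc j) (withActive K n j)
  flatten-levelBlocks j = flatten-chunks j (quota j) (withActive K n j)

  levelBlocks-activeCount : ∀ j → All (λ π → activeCount π ≡ j) (flatten (levelBlocks j))
  levelBlocks-activeCount j = subst (All _) (sym (flatten-levelBlocks j))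
    (All.take⁺ (quota j * suc j) (withActive-activeCount K n j))

  levelBlocks-separated : ∀ j → AllPairs Separated (flatten (levelBlocks j))
  levelBlocks-separated j = subst (AllPairs Separated) (sym (flatten-levelBlocks j))
    (AllPairs.take⁺ (quota j * suc j)
      (equal-activeCount-separated (withActive-activeCount K n j) (withActive-unique K n j)))

  levelBlocks-budgeted : ∀ j → All Budgeted (levelBlocks j)
  levelBlocks-budgeted j = All.zipWith (λ (head≡j , tail≡j) → ≤-reflexive (trans head≡j (sym tail≡j)))
    ( All-head (levelBlocks j) (levelBlocks-activeCount j)
    , chunks-tail j (quota j) (withActive K n j) (quota-fits j))

  flatten-blocks : ∀ j → flatten (blocks (suc j)) ≡ flatten (levelBlocks j) ++ flatten (blocks j)
  flatten-blocks j = concatMap-++ toList (levelBlocks j) (blocks j)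

  blocks-activeCount< : ∀ J → All (λ π → activeCount π < J) (flatten (blocks J))
  blocks-activeCount< zero    = []
  blocks-activeCount< (suc j) = subst (All _) (sym (flatten-blocks j)) (All.++⁺
    (All.map (s≤s ∘ ≤-reflexive) (levelBlocks-activeCount j))
    (All.map m≤n⇒m≤1+n (blocks-activeCount< j)))

  blocks-separated : ∀ J → AllPairs Separated (flatten (blocks J))
  blocks-separated zero    = []
  blocks-separated (suc j) = subst (AllPairs Separated) (sym (flatten-blocks j)) (AllPairs.++⁺
    (levelBlocks-separated j)
    (blocks-separated j)
    (All.map (λ {π} π≡j → All.map (λ {σ} σ<j → separated-< π σ (subst (activeCount σ <_) (sym π≡j) σ<j))
                                  (blocks-activeCount< j))
             (levelBlocks-activeCount j)))

  blocks-budgeted : ∀ J → All Budgeted (blocks J)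
  blocks-budgeted zero    = []
  blocks-budgeted (suc j) = All.++⁺ (levelBlocks-budgeted j) (blocks-budgeted j)

  length-blocks : ∀ J → length (blocks J) ≡ ∑[ j < J ] quota j
  length-blocks zero    = refl
  length-blocks (suc j) = trans (length-++ (levelBlocks j))
    (cong₂ _+_ (length-chunks j (quota j) (withActive K n j) (quota-fits j)) (length-blocks j))

  size : ℕ
  size = ∑[ j < suc n ] quota j

  pseudoPI : PseudoPI n (suc K) size
  pseudoPI = subst (PseudoPI n (suc K)) (length-blocks (suc n))
    (blocksPseudoPI (blocks (suc n)) (blocks-separated (suc n)) (blocks-budgeted (suc n)))

  W : ℕ
  W = suc n * K

  quota-bounds : ∀ j → W * quota j ≤ numWithActive K (suc n) (suc j)
                     × numWithActive K (suc n) (suc j) ≤ W * quota j + W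
  quota-bounds j = quotient-sandwich {d = j} {w = W} (numWithActive-absorption K n j)

  size-lower : suc (W * size) ≤ suc K ^ suc n
  size-lower = begin
    suc (W * size)                                          ≡⟨ cong suc (*-distribˡ-∑ W (suc n) quota) ⟩
    suc (∑[ j < suc n ] (W * quota j))                      ≤⟨ s≤s (∑-mono-≤ (suc n) (proj₁ ∘ quota-bounds)) ⟩
    suc (∑[ j < suc n ] numWithActive K (suc n) (suc j))    ≡⟨ ∑-numWithActive-positive K (suc n) ⟩
    suc K ^ suc n                                           ∎
    where open ≤-Reasoning

  size-upper : suc K ^ suc n ≤ suc (W * size + suc n * W)
  size-upper = begin
    suc K ^ suc n                                           ≡⟨ ∑-numWithActive-positive K (suc n) ⟨
    suc (∑[ j < suc n ] numWithActive K (suc n) (suc j))    ≤⟨ s≤s (∑-mono-≤ (suc n) (proj₂ ∘ quota-bounds)) ⟩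
    suc (∑[ j < suc n ] (W * quota j + W))                  ≡⟨ cong suc (∑-+-const (suc n) (λ j → W * quota j) W) ⟩
    suc (∑[ j < suc n ] (W * quota j) + suc n * W)          ≡⟨ cong (λ x → suc (x + suc n * W)) (*-distribˡ-∑ W (suc n) quota) ⟨
    suc (W * size + suc n * W)                              ∎
    where open ≤-Reasoning

[1+n]^4≤2^n : ∀ {n} → 17 ≤ n → suc n ^ 4 ≤ 2 ^ n
[1+n]^4≤2^n {n} 17≤n = subst (λ m → suc m ^ 4 ≤ 2 ^ m) (m+[n∸m]≡n 17≤n) (from-17 (n ∸ 17))
  where
  from-17 : ∀ t → suc (17 + t) ^ 4 ≤ 2 ^ (17 + t)
  from-17 zero    = ≤ᵇ⇒≤ (18 ^ 4) (2 ^ 17) _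
  from-17 (suc t) = begin
    suc (17 + suc t) ^ 4                ≤⟨ m≤m+n _ _ ⟩
    suc (17 + suc t) ^ 4 + _            ≡⟨ doubling t ⟩
    2 * suc (17 + t) ^ 4                ≤⟨ *-monoʳ-≤ 2 (from-17 t) ⟩
    2 * 2 ^ (17 + t)                    ∎
    where
    open ≤-Reasoning
    doubling : ∀ t → let x = 19 + t; y = 18 + t in
      x * (x * (x * (x * 1))) + (t * t * t * t + 68 * t * t * t + 1722 * t * t + 19220 * t + 79631)
        ≡ 2 * (y * (y * (y * (y * 1))))
    doubling = solve-∀

[1+K]^[1+n]≤2K[1+K]^n : ∀ {K} n → 1 ≤ K → suc K ^ suc n ≤ 2 * K * suc K ^ n
[1+K]^[1+n]≤2K[1+K]^n {K} n 1≤K = *-monoˡ-≤ (suc K ^ n) (begin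
  suc K      ≤⟨ +-monoˡ-≤ K 1≤K ⟩
  K + K      ≡⟨ cong (K +_) (+-identityʳ K) ⟨
  2 * K      ∎)
  where open ≤-Reasoning

cubic-error-small : ∀ {K q} n → 1 ≤ K → 2 * q + 17 ≤ n →
  q * (suc n + suc n * (suc n * (suc n * K))) ≤ K * suc K ^ n
cubic-error-small {K} {q} n 1≤K n≥N = begin
  q * (s + Y)                ≤⟨ *-monoʳ-≤ q (+-monoˡ-≤ Y s≤Y) ⟩
  q * (Y + Y)                ≡⟨ double q Y ⟩
  2 * q * Y                  ≤⟨ *-monoˡ-≤ Y (≤-trans (m≤m+n (2 * q) 17) (≤-trans n≥N (n≤1+n n))) ⟩
  s * Y                      ≡⟨ quartic n K ⟩
  s ^ 4 * K                  ≤⟨ *-monoˡ-≤ K ([1+n]^4≤2^n (≤-trans (m≤n+m 17 (2 * q)) n≥N)) ⟩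
  2 ^ n * K                  ≤⟨ *-monoˡ-≤ K (^-monoˡ-≤ n (s≤s 1≤K)) ⟩
  suc K ^ n * K              ≡⟨ *-comm (suc K ^ n) K ⟩
  K * suc K ^ n              ∎
  where
  open ≤-Reasoning
  s = suc n
  Y = s * (s * (s * K))
  s≤Y : s ≤ Y
  s≤Y = subst (_≤ Y) (*-identityʳ s) (*-monoʳ-≤ s (*-mono-≤ (s≤s (z≤n {n})) (*-mono-≤ (s≤s (z≤n {n})) 1≤K)))
  double : ∀ q y → q * (y + y) ≡ 2 * q * y
  double = solve-∀
  quartic : ∀ n K → let s = suc n in s * (s * (s * (s * K))) ≡ s * (s * (s * (s * 1))) * K
  quartic = solve-∀

undershoot-bound : ∀ {K n m} → let s = suc n; P = suc K ^ suc n in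
  s * K * m < P → P ≤ suc (s * K * m + s * (s * K)) →
  m * n * K ≤ P × s * (P ∸ m * n * K) ≤ P + (s + s * (s * (s * K)))
undershoot-bound {K} {n} {m} Wm<P P≤ = B≤P , (begin
  s * (P ∸ B)                              ≤⟨ *-monoʳ-≤ s (m≤n+o⇒m∸n≤o P B (subst (P ≤_) (peel n m K) P≤)) ⟩
  s * suc (m * K + s * (s * K))            ≡⟨ expand n m K ⟩
  s * K * m + (s + s * (s * (s * K)))      ≤⟨ +-monoˡ-≤ _ (<⇒≤ Wm<P) ⟩
  P + (s + s * (s * (s * K)))              ∎)
  where
  open ≤-Reasoning
  s = suc n
  P = suc K ^ suc n
  B = m * n * K
  Wm≡B+mK : s * K * m ≡ B + m * K
  Wm≡B+mK = split n m K
    where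
    split : ∀ n m K → suc n * K * m ≡ m * n * K + m * K
    split = solve-∀
  B≤P : B ≤ P
  B≤P = ≤-trans (m≤m+n B (m * K)) (≤-trans (≤-reflexive (sym Wm≡B+mK)) (<⇒≤ Wm<P))
  peel : ∀ n m K → suc (suc n * K * m + suc n * (suc n * K)) ≡ m * n * K + suc (m * K + suc n * (suc n * K))
  peel = solve-∀
  expand : ∀ n m K → suc n * suc (m * K + suc n * (suc n * K)) ≡ suc n * K * m + (suc n + suc n * (suc n * (suc n * K)))
  expand = solve-∀

asymptotic-error : ∀ {K q n m} → 1 ≤ K → 2 * q + 17 ≤ n →
  suc n * K * m < suc K ^ suc n → suc K ^ suc n ≤ suc (suc n * K * m + suc n * (suc n * K)) →
  q * ∣ m * n * K - suc K ^ suc n ∣ ≤ K * suc K ^ n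
asymptotic-error {K} {q} {n} {m} 1≤K n≥N Wm<P P≤ with undershoot-bound {K} {n} {m} Wm<P P≤
... | B≤P , sE≤ rewrite m≤n⇒∣m-n∣≡n∸m B≤P = *-cancelˡ-≤ (suc n) (begin
  suc n * (q * E)                    ≡⟨ swap (suc n) q E ⟩
  q * (suc n * E)                    ≤⟨ *-monoʳ-≤ q sE≤ ⟩
  q * (P + X)                        ≡⟨ *-distribˡ-+ q P X ⟩
  q * P + q * X                      ≤⟨ +-mono-≤ (*-monoʳ-≤ q ([1+K]^[1+n]≤2K[1+K]^n n 1≤K))
                                                 (cubic-error-small {q = q} n 1≤K n≥N) ⟩
  q * (2 * K * k^n) + K * k^n        ≡⟨ regroup q K k^n ⟩
  (2 * q + 1) * (K * k^n)            ≤⟨ *-monoˡ-≤ (K * k^n) 2q+1≤1+n ⟩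
  suc n * (K * k^n)                  ∎)
  where
  open ≤-Reasoning
  P = suc K ^ suc n
  E = P ∸ m * n * K
  X = suc n + suc n * (suc n * (suc n * K))
  k^n = suc K ^ n
  2q+1≤1+n : 2 * q + 1 ≤ suc n
  2q+1≤1+n = ≤-trans (+-monoʳ-≤ (2 * q) (s≤s z≤n)) (≤-trans n≥N (n≤1+n n))
  swap : ∀ x y z → x * (y * z) ≡ y * (x * z)
  swap = solve-∀
  regroup : ∀ q K y → q * (2 * K * y) + K * y ≡ (2 * q + 1) * (K * y)
  regroup = solve-∀

theorem2 : (k : ℕ) → 2 ≤ k →
    Σ ((n : ℕ) → Σ ℕ (λ m → PseudoPI n k m)) λ f →
      ∀ (q : ℕ) → 1 ≤ q → ∃ λ N → ∀ n → N ≤ n →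
        q * ∣ proj₁ (f n) * n * (k ∸ 1) - k ^ (n + 1) ∣ ≤ (k ∸ 1) * k ^ n
theorem2 (suc (suc K)) (s≤s (s≤s z≤n)) = family , λ q _ → 2 * q + 17 , λ n n≥N → error q n n≥N
  where
  family : (n : ℕ) → Σ ℕ (PseudoPI n (suc (suc K)))
  family n = Construction.size (suc K) n , Construction.pseudoPI (suc K) n
  error : ∀ q n → 2 * q + 17 ≤ n →
    q * ∣ proj₁ (family n) * n * suc K - suc (suc K) ^ (n + 1) ∣ ≤ suc K * suc (suc K) ^ n
  error q n n≥N rewrite +-comm n 1 = asymptotic-error {q = q} (s≤s z≤n) n≥N
    (Construction.size-lower (suc K) n) (Construction.size-upper (suc K) n)
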